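{- Let $s$ be a process, $t$ a term, $a$ a term variable and $k\in\mathbb N$. If $s[a:=t]\Downarrow_{\rightsquigarrow_k}$ then there is a blocked process $p$ with $s\succ^*p$ such that one of the following holds: (i) $p=v\ast\alpha$ for some value $v$ and stack variable $\alpha$; (ii) $p=a\ast\pi$ for some stack $\pi$; (iii) $k>0$ and $p=\delta_{v,w}\ast\pi$ for some values $v,w$ and stack $\pi$, and in this case $v[a:=t]\not\equiv_j w[a:=t]$ for some $j<k$.
   Context: Fix pairwise disjoint countably infinite sets of $\lambda$-variables ($x,y,\dots$), stack variables ($\alpha,\beta,\dots$), term variables ($a,b,\dots$), and countable sets of labels $l$ and constructors $C$. Values, terms, stacks, processes: $v,w::=x\mid\lambda x\,t\mid C[v]\mid\{l_i=v_i\}_{i\in I}$; $t,u::=a\mid v\mid t\,u\mid\mu\alpha\,t\mid p\mid v.l\mid\mathrm{case}_v[C_i[x_i]\to t_i]_{i\in I}\mid\delta_{v,w}$; $\pi::=\alpha\mid v.\pi\mid[t]\pi$; $p::=t\ast\pi$; $I$ finite; $\lambda x$, $\mu\alpha$ and the $x_i$ in case branches are binders, term variables are never bound. Substitutions map $\lambda$-variables to values, stack variables to stacks, term variables to terms (capture-avoiding). $\succ$ is the smallest relation on processes with: $t\,u\ast\pi\succ u\ast[t]\pi$; $v\ast[t]\pi\succ t\ast v.\pi$; $\lambda x\,t\ast v.\pi\succ t[x:=v]\ast\pi$; $\mu\alpha\,t\ast\pi\succ t[\alpha:=\pi]\ast\pi$; $p\ast\pi\succ p$; $\{l_i=v_i\}_{i\in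 I}.l_k\ast\pi\succ v_k\ast\pi$ ($k\in I$); $\mathrm{case}_{C_k[v]}[C_i[x_i]\to t_i]_{i\in I}\ast\pi\succ t_k[x_k:=v]\ast\pi$ ($k\in I$). A process is blocked if no $q$ satisfies $p\succ q$, and final if it is $v\ast\alpha$ with $v$ a value and $\alpha$ a stack variable; for a relation $R$, $p\Downarrow_R$ means $p\,R^*\,q$ with $q$ final. For $i\in\mathbb N$, inductively: $\rightsquigarrow_i=\succ\cup\{(\delta_{v,w}\ast\pi,v\ast\pi)\mid\exists j<i,\ v\not\equiv_jw\}$; $t\equiv_iu$ iff for all $j\le i$, stacks $\pi$, substitutions $\sigma$: $t\sigma\ast\pi\Downarrow_{\rightsquigarrow_j}\Leftrightarrow u\sigma\ast\pi\Downarrow_{\rightsquigarrow_j}$; $\not\equiv_i$ is its negation. -}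

module Defs where

open import Data.Nat using (ℕ; zero; suc; _<_; _≤_; _≟_)
open import Data.Product using (Σ; ∃; _×_; _,_)
open import Data.Sum using (_⊎_; inj₁; inj₂)
open import Data.Empty using (⊥)
open import Relation.Nullary using (¬_; yes; no)
open import Relation.Binary.PropositionalEquality using (_≡_)
open import Relation.Binary.Construct.Closure.ReflexiveTransitive using (Star)
open import Function.Bundles using (_⇔_)

-- Variables are de Bruijn indices (unscoped): λ-variables and
-- stack variables are ℕ-indices (index 0 = innermost binder, indices that
-- exceed the number of enclosing binders are free variables).  Term
-- variables are never bound, so they are simply named by ℕ.

TVar Label Con : Set
TVar  = ℕ
Label = ℕ
Con   = ℕ

mutual
  data Val : Set where
    var  : ℕ → Val
    lam  : Term → Val              -- λx t   (binds λ-index 0 in t)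
    con  : Con → Val → Val
    rec  : Fields → Val

  data Fields : Set where
    []   : Fields
    _↦_,_ : Label → Val → Fields → Fields

  data Term : Set where
    tvar  : TVar → Term
    val   : Val → Term
    app   : Term → Term → Term
    mu    : Term → Term            -- μα t   (binds stack index 0 in t)
    proc  : Proc → Term
    proj  : Val → Label → Term
    case  : Val → Branches → Term
    delta : Val → Val → Term

  -- finite families (C_i[x_i] → t_i)_{i ∈ I}; x_i is λ-index 0 in t_i
  data Branches : Set where
    []   : Branches
    _⇒_,_ : Con → Term → Branches → Branches

  data Stack : Set where
    svar  : ℕ → Stack
    push  : Val → Stack → Stack
    frame : Term → Stack → Stack

  data Proc : Set where
    _∗_ : Term → Stack → Proc

infix 4 _∈F_ _∈B_

data _∈F_ : Label × Val → Fields → Set where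
  here  : ∀ {l v fs} → (l , v) ∈F (l ↦ v , fs)
  there : ∀ {l v l' v' fs} → (l , v) ∈F fs → (l , v) ∈F (l' ↦ v' , fs)

data _∈B_ : Con × Term → Branches → Set where
  here  : ∀ {C t bs} → (C , t) ∈B (C ⇒ t , bs)
  there : ∀ {C t C' t' bs} → (C , t) ∈B bs → (C , t) ∈B (C' ⇒ t' , bs)

ext : (ℕ → ℕ) → ℕ → ℕ
ext f zero    = zero
ext f (suc n) = suc (f n)

record Ren : Set where
  field
    rl : ℕ → ℕ
    rs : ℕ → ℕ
open Ren

extL extS : Ren → Ren
extL ρ = record { rl = ext (rl ρ) ; rs = rs ρ }
extS ρ = record { rl = rl ρ ; rs = ext (rs ρ) }

mutual
  renV : Ren → Val → Val
  renV ρ (var x)   = var (rl ρ x)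
  renV ρ (lam t)   = lam (renT (extL ρ) t)
  renV ρ (con C v) = con C (renV ρ v)
  renV ρ (rec fs)  = rec (renF ρ fs)

  renF : Ren → Fields → Fields
  renF ρ []           = []
  renF ρ (l ↦ v , fs) = l ↦ renV ρ v , renF ρ fs

  renT : Ren → Term → Term
  renT ρ (tvar a)     = tvar a
  renT ρ (val v)      = val (renV ρ v)
  renT ρ (app t u)    = app (renT ρ t) (renT ρ u)
  renT ρ (mu t)       = mu (renT (extS ρ) t)
  renT ρ (proc p)     = proc (renP ρ p)
  renT ρ (proj v l)   = proj (renV ρ v) l
  renT ρ (case v bs)  = case (renV ρ v) (renB ρ bs)
  renT ρ (delta v w)  = delta (renV ρ v) (renV ρ w)

  renB : Ren → Branches → Branches
  renB ρ []           = []
  renB ρ (C ⇒ t , bs) = C ⇒ renT (extL ρ) t , renB ρ bs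

  renS : Ren → Stack → Stack
  renS ρ (svar α)    = svar (rs ρ α)
  renS ρ (push v π)  = push (renV ρ v) (renS ρ π)
  renS ρ (frame t π) = frame (renT ρ t) (renS ρ π)

  renP : Ren → Proc → Proc
  renP ρ (t ∗ π) = renT ρ t ∗ renS ρ π

wkL wkS : Ren
wkL = record { rl = suc ; rs = λ n → n }
wkS = record { rl = λ n → n ; rs = suc }

record Subst : Set where
  field
    sl : ℕ → Val
    ss : ℕ → Stack
    st : TVar → Term
open Subst

liftL liftS : Subst → Subst
liftL σ = record
  { sl = λ { zero → var zero ; (suc n) → renV wkL (sl σ n) }
  ; ss = λ n → renS wkL (ss σ n)
  ; st = λ a → renT wkL (st σ a) }
liftS σ = record
  { sl = λ n → renV wkS (sl σ n)
  ; ss = λ { zero → svar zero ; (suc n) → renS wkS (ss σ n) }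
  ; st = λ a → renT wkS (st σ a) }

mutual
  subV : Subst → Val → Val
  subV σ (var x)   = sl σ x
  subV σ (lam t)   = lam (subT (liftL σ) t)
  subV σ (con C v) = con C (subV σ v)
  subV σ (rec fs)  = rec (subF σ fs)

  subF : Subst → Fields → Fields
  subF σ []           = []
  subF σ (l ↦ v , fs) = l ↦ subV σ v , subF σ fs

  subT : Subst → Term → Term
  subT σ (tvar a)     = st σ a
  subT σ (val v)      = val (subV σ v)
  subT σ (app t u)    = app (subT σ t) (subT σ u)
  subT σ (mu t)       = mu (subT (liftS σ) t)
  subT σ (proc p)     = proc (subP σ p)
  subT σ (proj v l)   = proj (subV σ v) l
  subT σ (case v bs)  = case (subV σ v) (subB σ bs)
  subT σ (delta v w)  = delta (subV σ v) (subV σ w)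

  subB : Subst → Branches → Branches
  subB σ []           = []
  subB σ (C ⇒ t , bs) = C ⇒ subT (liftL σ) t , subB σ bs

  subS : Subst → Stack → Stack
  subS σ (svar α)    = ss σ α
  subS σ (push v π)  = push (subV σ v) (subS σ π)
  subS σ (frame t π) = frame (subT σ t) (subS σ π)

  subP : Subst → Proc → Proc
  subP σ (t ∗ π) = subT σ t ∗ subS σ π

idSubst : Subst
idSubst = record { sl = var ; ss = svar ; st = tvar }

_[0:=_]ᵛ : Term → Val → Term
t [0:= v ]ᵛ = subT (record idSubst { sl = λ { zero → v ; (suc n) → var n } }) t

_[0:=_]ˢ : Term → Stack → Term
t [0:= π ]ˢ = subT (record idSubst { ss = λ { zero → π ; (suc n) → svar n } }) t

tsub : TVar → Term → Subst
tsub a t = record idSubst { st = λ b → case′ (b ≟ a) }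
  where
  case′ : ∀ {b} → Relation.Nullary.Dec (b ≡ a) → Term
  case′ {b} (yes _) = t
  case′ {b} (no _)  = tvar b

_[_:=_]ᴾ : Proc → TVar → Term → Proc
s [ a := t ]ᴾ = subP (tsub a t) s

_[_:=_]ⱽ : Val → TVar → Term → Val
v [ a := t ]ⱽ = subV (tsub a t) v

infix 4 _≻_
data _≻_ : Proc → Proc → Set where
  ≻-app   : ∀ {t u π} → app t u ∗ π ≻ u ∗ frame t π
  ≻-frame : ∀ {v t π} → val v ∗ frame t π ≻ t ∗ push v π
  ≻-lam   : ∀ {t v π} → val (lam t) ∗ push v π ≻ (t [0:= v ]ᵛ) ∗ π
  ≻-mu    : ∀ {t π} → mu t ∗ π ≻ (t [0:= π ]ˢ) ∗ π
  ≻-proc  : ∀ {p π} → proc p ∗ π ≻ p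
  ≻-proj  : ∀ {fs l v π} → (l , v) ∈F fs → proj (rec fs) l ∗ π ≻ val v ∗ π
  ≻-case  : ∀ {C v bs t π} → (C , t) ∈B bs →
            case (con C v) bs ∗ π ≻ (t [0:= v ]ᵛ) ∗ π

Blocked : Proc → Set
Blocked p = ¬ (∃ λ q → p ≻ q)

Final : Proc → Set
Final p = Σ Val λ v → Σ ℕ λ α → p ≡ (val v ∗ svar α)

Conv : (Proc → Proc → Set) → Proc → Set
Conv R p = ∃ λ q → Star R p q × Final q

-- Paper:  ⇝_i = ≻ ∪ {(δ_{v,w} ∗ π , v ∗ π) | ∃ j < i, v ≢_j w}
--         t ≡_i u  iff  ∀ j ≤ i, π, σ:  tσ ∗ π ⇓_{⇝_j} ⇔ uσ ∗ π ⇓_{⇝_j}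
-- To make the mutual definition structurally recursive we define
--   Bad i v w      ("∃ j < i. v ≢_j w") and
--   Equiv i t u    ("t ≡_i u", i.e. "∀ j ≤ i. EqAt (⇝_j) t u")
-- by recursion on i; the lemmas Bad-spec / Equiv-spec below show that
-- they are exactly the paper's notions.

data DeltaStep (B : Val → Val → Set) : Proc → Proc → Set where
  δ-step : ∀ {v w π} → B v w → DeltaStep B (delta v w ∗ π) (val v ∗ π)

EqAt : (Proc → Proc → Set) → Term → Term → Set
EqAt R t u = ∀ (σ : Subst) (π : Stack) → Conv R (subT σ t ∗ π) ⇔ Conv R (subT σ u ∗ π)

mutual
  Red : ℕ → Proc → Proc → Set
  Red i p q = (p ≻ q) ⊎ DeltaStep (Bad i) p q

  Bad : ℕ → Val → Val → Set
  Bad zero    v w = ⊥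
  Bad (suc i) v w = Bad i v w ⊎ ¬ Equiv i (val v) (val w)

  Equiv : ℕ → Term → Term → Set
  Equiv zero    t u = EqAt (Red zero) t u
  Equiv (suc i) t u = Equiv i t u × EqAt (Red (suc i)) t u

NotEquiv : ℕ → Term → Term → Set
NotEquiv i t u = ¬ Equiv i t u

open import Data.Nat using (z≤n; s≤s)
open import Data.Nat.Properties using (m≤n⇒m<n∨m≡n; m≤n⇒m≤1+n; m<n⇒m<1+n; n<1+n; ≤-refl)
open import Relation.Binary.PropositionalEquality using (refl)
open import Function.Bundles using (mk⇔)
open import Data.Empty using (⊥-elim)

module _ {t u : Term} where
  private
    fwd : ∀ i → Equiv i t u → ∀ j → j ≤ i → EqAt (Red j) t u
    fwd zero e .zero z≤n = e
    fwd (suc i) (e , e') j j≤ with m≤n⇒m<n∨m≡n j≤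
    ... | inj₁ (s≤s j≤i) = fwd i e j j≤i
    ... | inj₂ refl = e'

    bwd : ∀ i → (∀ j → j ≤ i → EqAt (Red j) t u) → Equiv i t u
    bwd zero h = h zero z≤n
    bwd (suc i) h = bwd i (λ j p → h j (m≤n⇒m≤1+n p)) , h (suc i) ≤-refl

  Equiv-spec : ∀ i → Equiv i t u ⇔ (∀ j → j ≤ i → EqAt (Red j) t u)
  Equiv-spec i = mk⇔ (fwd i) (bwd i)

module _ {v w : Val} where
  private
    fwd : ∀ i → Bad i v w → Σ ℕ λ j → j < i × NotEquiv j (val v) (val w)
    fwd (suc i) (inj₁ b) with fwd i b
    ... | j , p , n = j , m<n⇒m<1+n p , n
    fwd (suc i) (inj₂ n) = i , n<1+n i , n

    bwd : ∀ i → (Σ ℕ λ j → j < i × NotEquiv j (val v) (val w)) → Bad i v w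
    bwd zero (j , () , n)
    bwd (suc i) (j , s≤s j≤i , n) with m≤n⇒m<n∨m≡n j≤i
    ... | inj₁ j<i = inj₁ (bwd i (j , j<i , n))
    ... | inj₂ refl = inj₂ n

  Bad-spec : ∀ i → Bad i v w ⇔ (Σ ℕ λ j → j < i × NotEquiv j (val v) (val w))
  Bad-spec i = mk⇔ (fwd i) (bwd i)

module Submission where

-- Write σ = [a:=t].  Term variables are never bound, so σ
-- touches neither λ-variables nor stack variables, and a process s whose
-- head is not a term variable reduces exactly like its instance sσ:
-- every ≻-step of sσ is the σ-instance of a ≻-step of s (simulation), a
-- final sσ comes from a final s, and a δ-redex sσ comes from a δ-redex s.
-- Following a ⇝_k-path from sσ to a final process step by step we thus
-- either reach a final process (case i), a δ_{v,w}-redex whose instance is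
-- contracted by ⇝_k, so that v[a:=t] ≢_j w[a:=t] for some j < k (case iii),
-- or a head term variable b; a head b ≠ a is stuck also after σ, so it
-- would not converge, hence b = a (case ii).

open import Defs
open import Data.Nat using (ℕ; zero; suc; _<_; _>_; _≟_; s≤s; z≤n)
open import Data.Product using (Σ; ∃; _×_; _,_)
open import Data.Sum using (_⊎_; inj₁; inj₂)
open import Data.Empty using (⊥-elim)
open import Relation.Nullary using (¬_; yes; no)
open import Relation.Nullary.Decidable using (decidable-stable)
open import Relation.Binary.PropositionalEquality
  using (_≡_; _≢_; refl; sym; trans; cong; cong₂; subst)
open import Relation.Binary.Construct.Closure.ReflexiveTransitive using (Star; ε; _◅_)
open import Function.Bundles using (Equivalence)
open Ren
open Subst

record RenRen (ρ₁ ρ₂ ρ₃ : Ren) : Set where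
  field
    onLVar : ∀ n → rl ρ₂ (rl ρ₁ n) ≡ rl ρ₃ n
    onSVar : ∀ n → rs ρ₂ (rs ρ₁ n) ≡ rs ρ₃ n

record SubRen (ρ : Ren) (σ σ' : Subst) : Set where
  field
    onLVar : ∀ n → sl σ (rl ρ n) ≡ sl σ' n
    onSVar : ∀ n → ss σ (rs ρ n) ≡ ss σ' n
    onTVar : ∀ b → st σ b ≡ st σ' b

record RenSub (σ : Subst) (ρ : Ren) (σ' : Subst) : Set where
  field
    onLVar : ∀ n → renV ρ (sl σ n) ≡ sl σ' n
    onSVar : ∀ n → renS ρ (ss σ n) ≡ ss σ' n
    onTVar : ∀ b → renT ρ (st σ b) ≡ st σ' b

record SubSub (σ₁ σ₂ σ₃ : Subst) : Set where
  field
    onLVar : ∀ n → subV σ₂ (sl σ₁ n) ≡ sl σ₃ n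
    onSVar : ∀ n → subS σ₂ (ss σ₁ n) ≡ ss σ₃ n
    onTVar : ∀ b → subT σ₂ (st σ₁ b) ≡ st σ₃ b

record IsId (σ : Subst) : Set where
  field
    onLVar : ∀ n → sl σ n ≡ var n
    onSVar : ∀ n → ss σ n ≡ svar n
    onTVar : ∀ b → st σ b ≡ tvar b

RenRen-extL : ∀ {ρ₁ ρ₂ ρ₃} → RenRen ρ₁ ρ₂ ρ₃ → RenRen (extL ρ₁) (extL ρ₂) (extL ρ₃)
RenRen-extL h = record
  { onLVar = λ { zero → refl ; (suc n) → cong suc (RenRen.onLVar h n) }
  ; onSVar = RenRen.onSVar h }

RenRen-extS : ∀ {ρ₁ ρ₂ ρ₃} → RenRen ρ₁ ρ₂ ρ₃ → RenRen (extS ρ₁) (extS ρ₂) (extS ρ₃)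
RenRen-extS h = record
  { onLVar = RenRen.onLVar h
  ; onSVar = λ { zero → refl ; (suc n) → cong suc (RenRen.onSVar h n) } }

mutual
  ren-renV : ∀ {ρ₁ ρ₂ ρ₃} → RenRen ρ₁ ρ₂ ρ₃ → ∀ v → renV ρ₂ (renV ρ₁ v) ≡ renV ρ₃ v
  ren-renV h (var x)   = cong var (RenRen.onLVar h x)
  ren-renV h (lam t)   = cong lam (ren-renT (RenRen-extL h) t)
  ren-renV h (con C v) = cong (con C) (ren-renV h v)
  ren-renV h (rec fs)  = cong rec (ren-renF h fs)

  ren-renF : ∀ {ρ₁ ρ₂ ρ₃} → RenRen ρ₁ ρ₂ ρ₃ → ∀ fs → renF ρ₂ (renF ρ₁ fs) ≡ renF ρ₃ fs
  ren-renF h []           = refl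
  ren-renF h (l ↦ v , fs) = cong₂ (l ↦_,_) (ren-renV h v) (ren-renF h fs)

  ren-renT : ∀ {ρ₁ ρ₂ ρ₃} → RenRen ρ₁ ρ₂ ρ₃ → ∀ t → renT ρ₂ (renT ρ₁ t) ≡ renT ρ₃ t
  ren-renT h (tvar b)    = refl
  ren-renT h (val v)     = cong val (ren-renV h v)
  ren-renT h (app t u)   = cong₂ app (ren-renT h t) (ren-renT h u)
  ren-renT h (mu t)      = cong mu (ren-renT (RenRen-extS h) t)
  ren-renT h (proc p)    = cong proc (ren-renP h p)
  ren-renT h (proj v l)  = cong (λ v′ → proj v′ l) (ren-renV h v)
  ren-renT h (case v bs) = cong₂ case (ren-renV h v) (ren-renB h bs)
  ren-renT h (delta v w) = cong₂ delta (ren-renV h v) (ren-renV h w)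

  ren-renB : ∀ {ρ₁ ρ₂ ρ₃} → RenRen ρ₁ ρ₂ ρ₃ → ∀ bs → renB ρ₂ (renB ρ₁ bs) ≡ renB ρ₃ bs
  ren-renB h []           = refl
  ren-renB h (C ⇒ t , bs) = cong₂ (C ⇒_,_) (ren-renT (RenRen-extL h) t) (ren-renB h bs)

  ren-renS : ∀ {ρ₁ ρ₂ ρ₃} → RenRen ρ₁ ρ₂ ρ₃ → ∀ π → renS ρ₂ (renS ρ₁ π) ≡ renS ρ₃ π
  ren-renS h (svar α)    = cong svar (RenRen.onSVar h α)
  ren-renS h (push v π)  = cong₂ push (ren-renV h v) (ren-renS h π)
  ren-renS h (frame t π) = cong₂ frame (ren-renT h t) (ren-renS h π)

  ren-renP : ∀ {ρ₁ ρ₂ ρ₃} → RenRen ρ₁ ρ₂ ρ₃ → ∀ p → renP ρ₂ (renP ρ₁ p) ≡ renP ρ₃ p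
  ren-renP h (t ∗ π) = cong₂ _∗_ (ren-renT h t) (ren-renS h π)

module _ (ρ : Ren) where
  private
    ρᴸ ρˢ : Ren
    ρᴸ = record { rl = λ n → suc (rl ρ n) ; rs = rs ρ }
    ρˢ = record { rl = rl ρ ; rs = λ n → suc (rs ρ n) }

    ext∘wkL : RenRen wkL (extL ρ) ρᴸ
    ext∘wkL = record { onLVar = λ _ → refl ; onSVar = λ _ → refl }
    wkL∘ρ : RenRen ρ wkL ρᴸ
    wkL∘ρ = record { onLVar = λ _ → refl ; onSVar = λ _ → refl }
    ext∘wkS : RenRen wkS (extS ρ) ρˢ
    ext∘wkS = record { onLVar = λ _ → refl ; onSVar = λ _ → refl }
    wkS∘ρ : RenRen ρ wkS ρˢ
    wkS∘ρ = record { onLVar = λ _ → refl ; onSVar = λ _ → refl }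

  extL-wkL-V : ∀ v → renV (extL ρ) (renV wkL v) ≡ renV wkL (renV ρ v)
  extL-wkL-V v = trans (ren-renV ext∘wkL v) (sym (ren-renV wkL∘ρ v))
  extL-wkL-S : ∀ π → renS (extL ρ) (renS wkL π) ≡ renS wkL (renS ρ π)
  extL-wkL-S π = trans (ren-renS ext∘wkL π) (sym (ren-renS wkL∘ρ π))
  extL-wkL-T : ∀ t → renT (extL ρ) (renT wkL t) ≡ renT wkL (renT ρ t)
  extL-wkL-T t = trans (ren-renT ext∘wkL t) (sym (ren-renT wkL∘ρ t))
  extS-wkS-V : ∀ v → renV (extS ρ) (renV wkS v) ≡ renV wkS (renV ρ v)
  extS-wkS-V v = trans (ren-renV ext∘wkS v) (sym (ren-renV wkS∘ρ v))
  extS-wkS-S : ∀ π → renS (extS ρ) (renS wkS π) ≡ renS wkS (renS ρ π)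
  extS-wkS-S π = trans (ren-renS ext∘wkS π) (sym (ren-renS wkS∘ρ π))
  extS-wkS-T : ∀ t → renT (extS ρ) (renT wkS t) ≡ renT wkS (renT ρ t)
  extS-wkS-T t = trans (ren-renT ext∘wkS t) (sym (ren-renT wkS∘ρ t))

SubRen-liftL : ∀ {ρ σ σ'} → SubRen ρ σ σ' → SubRen (extL ρ) (liftL σ) (liftL σ')
SubRen-liftL h = record
  { onLVar = λ { zero → refl ; (suc n) → cong (renV wkL) (SubRen.onLVar h n) }
  ; onSVar = λ n → cong (renS wkL) (SubRen.onSVar h n)
  ; onTVar = λ b → cong (renT wkL) (SubRen.onTVar h b) }

SubRen-liftS : ∀ {ρ σ σ'} → SubRen ρ σ σ' → SubRen (extS ρ) (liftS σ) (liftS σ')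
SubRen-liftS h = record
  { onLVar = λ n → cong (renV wkS) (SubRen.onLVar h n)
  ; onSVar = λ { zero → refl ; (suc n) → cong (renS wkS) (SubRen.onSVar h n) }
  ; onTVar = λ b → cong (renT wkS) (SubRen.onTVar h b) }

mutual
  sub-renV : ∀ {ρ σ σ'} → SubRen ρ σ σ' → ∀ v → subV σ (renV ρ v) ≡ subV σ' v
  sub-renV h (var x)   = SubRen.onLVar h x
  sub-renV h (lam t)   = cong lam (sub-renT (SubRen-liftL h) t)
  sub-renV h (con C v) = cong (con C) (sub-renV h v)
  sub-renV h (rec fs)  = cong rec (sub-renF h fs)

  sub-renF : ∀ {ρ σ σ'} → SubRen ρ σ σ' → ∀ fs → subF σ (renF ρ fs) ≡ subF σ' fs
  sub-renF h []           = refl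
  sub-renF h (l ↦ v , fs) = cong₂ (l ↦_,_) (sub-renV h v) (sub-renF h fs)

  sub-renT : ∀ {ρ σ σ'} → SubRen ρ σ σ' → ∀ t → subT σ (renT ρ t) ≡ subT σ' t
  sub-renT h (tvar b)    = SubRen.onTVar h b
  sub-renT h (val v)     = cong val (sub-renV h v)
  sub-renT h (app t u)   = cong₂ app (sub-renT h t) (sub-renT h u)
  sub-renT h (mu t)      = cong mu (sub-renT (SubRen-liftS h) t)
  sub-renT h (proc p)    = cong proc (sub-renP h p)
  sub-renT h (proj v l)  = cong (λ v′ → proj v′ l) (sub-renV h v)
  sub-renT h (case v bs) = cong₂ case (sub-renV h v) (sub-renB h bs)
  sub-renT h (delta v w) = cong₂ delta (sub-renV h v) (sub-renV h w)

  sub-renB : ∀ {ρ σ σ'} → SubRen ρ σ σ' → ∀ bs → subB σ (renB ρ bs) ≡ subB σ' bs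
  sub-renB h []           = refl
  sub-renB h (C ⇒ t , bs) = cong₂ (C ⇒_,_) (sub-renT (SubRen-liftL h) t) (sub-renB h bs)

  sub-renS : ∀ {ρ σ σ'} → SubRen ρ σ σ' → ∀ π → subS σ (renS ρ π) ≡ subS σ' π
  sub-renS h (svar α)    = SubRen.onSVar h α
  sub-renS h (push v π)  = cong₂ push (sub-renV h v) (sub-renS h π)
  sub-renS h (frame t π) = cong₂ frame (sub-renT h t) (sub-renS h π)

  sub-renP : ∀ {ρ σ σ'} → SubRen ρ σ σ' → ∀ p → subP σ (renP ρ p) ≡ subP σ' p
  sub-renP h (t ∗ π) = cong₂ _∗_ (sub-renT h t) (sub-renS h π)

RenSub-extL : ∀ {σ ρ σ'} → RenSub σ ρ σ' → RenSub (liftL σ) (extL ρ) (liftL σ')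
RenSub-extL {σ} {ρ} h = record
  { onLVar = λ { zero → refl
               ; (suc n) → trans (extL-wkL-V ρ (sl σ n)) (cong (renV wkL) (RenSub.onLVar h n)) }
  ; onSVar = λ n → trans (extL-wkL-S ρ (ss σ n)) (cong (renS wkL) (RenSub.onSVar h n))
  ; onTVar = λ b → trans (extL-wkL-T ρ (st σ b)) (cong (renT wkL) (RenSub.onTVar h b)) }

RenSub-extS : ∀ {σ ρ σ'} → RenSub σ ρ σ' → RenSub (liftS σ) (extS ρ) (liftS σ')
RenSub-extS {σ} {ρ} h = record
  { onLVar = λ n → trans (extS-wkS-V ρ (sl σ n)) (cong (renV wkS) (RenSub.onLVar h n))
  ; onSVar = λ { zero → refl
               ; (suc n) → trans (extS-wkS-S ρ (ss σ n)) (cong (renS wkS) (RenSub.onSVar h n)) }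
  ; onTVar = λ b → trans (extS-wkS-T ρ (st σ b)) (cong (renT wkS) (RenSub.onTVar h b)) }

mutual
  ren-subV : ∀ {σ ρ σ'} → RenSub σ ρ σ' → ∀ v → renV ρ (subV σ v) ≡ subV σ' v
  ren-subV h (var x)   = RenSub.onLVar h x
  ren-subV h (lam t)   = cong lam (ren-subT (RenSub-extL h) t)
  ren-subV h (con C v) = cong (con C) (ren-subV h v)
  ren-subV h (rec fs)  = cong rec (ren-subF h fs)

  ren-subF : ∀ {σ ρ σ'} → RenSub σ ρ σ' → ∀ fs → renF ρ (subF σ fs) ≡ subF σ' fs
  ren-subF h []           = refl
  ren-subF h (l ↦ v , fs) = cong₂ (l ↦_,_) (ren-subV h v) (ren-subF h fs)

  ren-subT : ∀ {σ ρ σ'} → RenSub σ ρ σ' → ∀ t → renT ρ (subT σ t) ≡ subT σ' t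
  ren-subT h (tvar b)    = RenSub.onTVar h b
  ren-subT h (val v)     = cong val (ren-subV h v)
  ren-subT h (app t u)   = cong₂ app (ren-subT h t) (ren-subT h u)
  ren-subT h (mu t)      = cong mu (ren-subT (RenSub-extS h) t)
  ren-subT h (proc p)    = cong proc (ren-subP h p)
  ren-subT h (proj v l)  = cong (λ v′ → proj v′ l) (ren-subV h v)
  ren-subT h (case v bs) = cong₂ case (ren-subV h v) (ren-subB h bs)
  ren-subT h (delta v w) = cong₂ delta (ren-subV h v) (ren-subV h w)

  ren-subB : ∀ {σ ρ σ'} → RenSub σ ρ σ' → ∀ bs → renB ρ (subB σ bs) ≡ subB σ' bs
  ren-subB h []           = refl
  ren-subB h (C ⇒ t , bs) = cong₂ (C ⇒_,_) (ren-subT (RenSub-extL h) t) (ren-subB h bs)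

  ren-subS : ∀ {σ ρ σ'} → RenSub σ ρ σ' → ∀ π → renS ρ (subS σ π) ≡ subS σ' π
  ren-subS h (svar α)    = RenSub.onSVar h α
  ren-subS h (push v π)  = cong₂ push (ren-subV h v) (ren-subS h π)
  ren-subS h (frame t π) = cong₂ frame (ren-subT h t) (ren-subS h π)

  ren-subP : ∀ {σ ρ σ'} → RenSub σ ρ σ' → ∀ p → renP ρ (subP σ p) ≡ subP σ' p
  ren-subP h (t ∗ π) = cong₂ _∗_ (ren-subT h t) (ren-subS h π)

module _ (σ : Subst) where
  private
    σᴸ σˢ : Subst
    σᴸ = record { sl = λ n → renV wkL (sl σ n) ; ss = λ n → renS wkL (ss σ n) ; st = λ b → renT wkL (st σ b) }
    σˢ = record { sl = λ n → renV wkS (sl σ n) ; ss = λ n → renS wkS (ss σ n) ; st = λ b → renT wkS (st σ b) }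

    liftL∘wkL : SubRen wkL (liftL σ) σᴸ
    liftL∘wkL = record { onLVar = λ _ → refl ; onSVar = λ _ → refl ; onTVar = λ _ → refl }
    wkL∘σ : RenSub σ wkL σᴸ
    wkL∘σ = record { onLVar = λ _ → refl ; onSVar = λ _ → refl ; onTVar = λ _ → refl }
    liftS∘wkS : SubRen wkS (liftS σ) σˢ
    liftS∘wkS = record { onLVar = λ _ → refl ; onSVar = λ _ → refl ; onTVar = λ _ → refl }
    wkS∘σ : RenSub σ wkS σˢ
    wkS∘σ = record { onLVar = λ _ → refl ; onSVar = λ _ → refl ; onTVar = λ _ → refl }

  liftL-wkL-V : ∀ v → subV (liftL σ) (renV wkL v) ≡ renV wkL (subV σ v)
  liftL-wkL-V v = trans (sub-renV liftL∘wkL v) (sym (ren-subV wkL∘σ v))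
  liftL-wkL-S : ∀ π → subS (liftL σ) (renS wkL π) ≡ renS wkL (subS σ π)
  liftL-wkL-S π = trans (sub-renS liftL∘wkL π) (sym (ren-subS wkL∘σ π))
  liftL-wkL-T : ∀ t → subT (liftL σ) (renT wkL t) ≡ renT wkL (subT σ t)
  liftL-wkL-T t = trans (sub-renT liftL∘wkL t) (sym (ren-subT wkL∘σ t))
  liftS-wkS-V : ∀ v → subV (liftS σ) (renV wkS v) ≡ renV wkS (subV σ v)
  liftS-wkS-V v = trans (sub-renV liftS∘wkS v) (sym (ren-subV wkS∘σ v))
  liftS-wkS-S : ∀ π → subS (liftS σ) (renS wkS π) ≡ renS wkS (subS σ π)
  liftS-wkS-S π = trans (sub-renS liftS∘wkS π) (sym (ren-subS wkS∘σ π))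
  liftS-wkS-T : ∀ t → subT (liftS σ) (renT wkS t) ≡ renT wkS (subT σ t)
  liftS-wkS-T t = trans (sub-renT liftS∘wkS t) (sym (ren-subT wkS∘σ t))

SubSub-liftL : ∀ {σ₁ σ₂ σ₃} → SubSub σ₁ σ₂ σ₃ → SubSub (liftL σ₁) (liftL σ₂) (liftL σ₃)
SubSub-liftL {σ₁} {σ₂} h = record
  { onLVar = λ { zero → refl
               ; (suc n) → trans (liftL-wkL-V σ₂ (sl σ₁ n)) (cong (renV wkL) (SubSub.onLVar h n)) }
  ; onSVar = λ n → trans (liftL-wkL-S σ₂ (ss σ₁ n)) (cong (renS wkL) (SubSub.onSVar h n))
  ; onTVar = λ b → trans (liftL-wkL-T σ₂ (st σ₁ b)) (cong (renT wkL) (SubSub.onTVar h b)) }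

SubSub-liftS : ∀ {σ₁ σ₂ σ₃} → SubSub σ₁ σ₂ σ₃ → SubSub (liftS σ₁) (liftS σ₂) (liftS σ₃)
SubSub-liftS {σ₁} {σ₂} h = record
  { onLVar = λ n → trans (liftS-wkS-V σ₂ (sl σ₁ n)) (cong (renV wkS) (SubSub.onLVar h n))
  ; onSVar = λ { zero → refl
               ; (suc n) → trans (liftS-wkS-S σ₂ (ss σ₁ n)) (cong (renS wkS) (SubSub.onSVar h n)) }
  ; onTVar = λ b → trans (liftS-wkS-T σ₂ (st σ₁ b)) (cong (renT wkS) (SubSub.onTVar h b)) }

mutual
  sub-subV : ∀ {σ₁ σ₂ σ₃} → SubSub σ₁ σ₂ σ₃ → ∀ v → subV σ₂ (subV σ₁ v) ≡ subV σ₃ v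
  sub-subV h (var x)   = SubSub.onLVar h x
  sub-subV h (lam t)   = cong lam (sub-subT (SubSub-liftL h) t)
  sub-subV h (con C v) = cong (con C) (sub-subV h v)
  sub-subV h (rec fs)  = cong rec (sub-subF h fs)

  sub-subF : ∀ {σ₁ σ₂ σ₃} → SubSub σ₁ σ₂ σ₃ → ∀ fs → subF σ₂ (subF σ₁ fs) ≡ subF σ₃ fs
  sub-subF h []           = refl
  sub-subF h (l ↦ v , fs) = cong₂ (l ↦_,_) (sub-subV h v) (sub-subF h fs)

  sub-subT : ∀ {σ₁ σ₂ σ₃} → SubSub σ₁ σ₂ σ₃ → ∀ t → subT σ₂ (subT σ₁ t) ≡ subT σ₃ t
  sub-subT h (tvar b)    = SubSub.onTVar h b
  sub-subT h (val v)     = cong val (sub-subV h v)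
  sub-subT h (app t u)   = cong₂ app (sub-subT h t) (sub-subT h u)
  sub-subT h (mu t)      = cong mu (sub-subT (SubSub-liftS h) t)
  sub-subT h (proc p)    = cong proc (sub-subP h p)
  sub-subT h (proj v l)  = cong (λ v′ → proj v′ l) (sub-subV h v)
  sub-subT h (case v bs) = cong₂ case (sub-subV h v) (sub-subB h bs)
  sub-subT h (delta v w) = cong₂ delta (sub-subV h v) (sub-subV h w)

  sub-subB : ∀ {σ₁ σ₂ σ₃} → SubSub σ₁ σ₂ σ₃ → ∀ bs → subB σ₂ (subB σ₁ bs) ≡ subB σ₃ bs
  sub-subB h []           = refl
  sub-subB h (C ⇒ t , bs) = cong₂ (C ⇒_,_) (sub-subT (SubSub-liftL h) t) (sub-subB h bs)

  sub-subS : ∀ {σ₁ σ₂ σ₃} → SubSub σ₁ σ₂ σ₃ → ∀ π → subS σ₂ (subS σ₁ π) ≡ subS σ₃ π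
  sub-subS h (svar α)    = SubSub.onSVar h α
  sub-subS h (push v π)  = cong₂ push (sub-subV h v) (sub-subS h π)
  sub-subS h (frame t π) = cong₂ frame (sub-subT h t) (sub-subS h π)

  sub-subP : ∀ {σ₁ σ₂ σ₃} → SubSub σ₁ σ₂ σ₃ → ∀ p → subP σ₂ (subP σ₁ p) ≡ subP σ₃ p
  sub-subP h (t ∗ π) = cong₂ _∗_ (sub-subT h t) (sub-subS h π)

IsId-liftL : ∀ {σ} → IsId σ → IsId (liftL σ)
IsId-liftL h = record
  { onLVar = λ { zero → refl ; (suc n) → cong (renV wkL) (IsId.onLVar h n) }
  ; onSVar = λ n → cong (renS wkL) (IsId.onSVar h n)
  ; onTVar = λ b → cong (renT wkL) (IsId.onTVar h b) }

IsId-liftS : ∀ {σ} → IsId σ → IsId (liftS σ)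
IsId-liftS h = record
  { onLVar = λ n → cong (renV wkS) (IsId.onLVar h n)
  ; onSVar = λ { zero → refl ; (suc n) → cong (renS wkS) (IsId.onSVar h n) }
  ; onTVar = λ b → cong (renT wkS) (IsId.onTVar h b) }

mutual
  sub-idV : ∀ {σ} → IsId σ → ∀ v → subV σ v ≡ v
  sub-idV h (var x)   = IsId.onLVar h x
  sub-idV h (lam t)   = cong lam (sub-idT (IsId-liftL h) t)
  sub-idV h (con C v) = cong (con C) (sub-idV h v)
  sub-idV h (rec fs)  = cong rec (sub-idF h fs)

  sub-idF : ∀ {σ} → IsId σ → ∀ fs → subF σ fs ≡ fs
  sub-idF h []           = refl
  sub-idF h (l ↦ v , fs) = cong₂ (l ↦_,_) (sub-idV h v) (sub-idF h fs)

  sub-idT : ∀ {σ} → IsId σ → ∀ t → subT σ t ≡ t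
  sub-idT h (tvar b)    = IsId.onTVar h b
  sub-idT h (val v)     = cong val (sub-idV h v)
  sub-idT h (app t u)   = cong₂ app (sub-idT h t) (sub-idT h u)
  sub-idT h (mu t)      = cong mu (sub-idT (IsId-liftS h) t)
  sub-idT h (proc p)    = cong proc (sub-idP h p)
  sub-idT h (proj v l)  = cong (λ v′ → proj v′ l) (sub-idV h v)
  sub-idT h (case v bs) = cong₂ case (sub-idV h v) (sub-idB h bs)
  sub-idT h (delta v w) = cong₂ delta (sub-idV h v) (sub-idV h w)

  sub-idB : ∀ {σ} → IsId σ → ∀ bs → subB σ bs ≡ bs
  sub-idB h []           = refl
  sub-idB h (C ⇒ t , bs) = cong₂ (C ⇒_,_) (sub-idT (IsId-liftL h) t) (sub-idB h bs)

  sub-idS : ∀ {σ} → IsId σ → ∀ π → subS σ π ≡ π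
  sub-idS h (svar α)    = IsId.onSVar h α
  sub-idS h (push v π)  = cong₂ push (sub-idV h v) (sub-idS h π)
  sub-idS h (frame t π) = cong₂ frame (sub-idT h t) (sub-idS h π)

  sub-idP : ∀ {σ} → IsId σ → ∀ p → subP σ p ≡ p
  sub-idP h (t ∗ π) = cong₂ _∗_ (sub-idT h t) (sub-idS h π)

idSubst-IsId : IsId idSubst
idSubst-IsId = record { onLVar = λ _ → refl ; onSVar = λ _ → refl ; onTVar = λ _ → refl }

module _ {ρ : Ren} {ς : Subst} (undo : SubRen ρ ς idSubst) where
  sub-ren-cancelV : ∀ v → subV ς (renV ρ v) ≡ v
  sub-ren-cancelV v = trans (sub-renV undo v) (sub-idV idSubst-IsId v)
  sub-ren-cancelS : ∀ π → subS ς (renS ρ π) ≡ π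
  sub-ren-cancelS π = trans (sub-renS undo π) (sub-idS idSubst-IsId π)
  sub-ren-cancelT : ∀ t → subT ς (renT ρ t) ≡ t
  sub-ren-cancelT t = trans (sub-renT undo t) (sub-idT idSubst-IsId t)

-- τ instantiates the innermost λ-variable (resp. stack variable) with w
-- (resp. π) and maps every other variable to itself, shifted down.
record InstantiatesL (τ : Subst) (w : Val) : Set where
  field
    bound  : sl τ zero ≡ w
    others : SubRen wkL τ idSubst

record InstantiatesS (τ : Subst) (π : Stack) : Set where
  field
    bound  : ss τ zero ≡ π
    others : SubRen wkS τ idSubst

-- Substitution commutes with instantiating a bound variable: both sides
-- substitute σ w for the bound variable and σ for all the others.
sub-instantiateL : ∀ {τ τ' σ w} → InstantiatesL τ w → InstantiatesL τ' (subV σ w) →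
                   ∀ b → subT σ (subT τ b) ≡ subT τ' (subT (liftL σ) b)
sub-instantiateL {τ} {τ'} {σ} {w} inst inst' b =
  trans (sub-subT {σ₃ = σʷ} before b) (sym (sub-subT {σ₃ = σʷ} after b))
  where
  open InstantiatesL
  σʷ : Subst
  σʷ = record σ { sl = λ { zero → subV σ w ; (suc n) → sl σ n } }
  before : SubSub τ σ σʷ
  before = record
    { onLVar = λ { zero → cong (subV σ) (bound inst)
                 ; (suc n) → cong (subV σ) (SubRen.onLVar (others inst) n) }
    ; onSVar = λ n → cong (subS σ) (SubRen.onSVar (others inst) n)
    ; onTVar = λ c → cong (subT σ) (SubRen.onTVar (others inst) c) }
  after : SubSub (liftL σ) τ' σʷ
  after = record
    { onLVar = λ { zero → bound inst' ; (suc n) → sub-ren-cancelV (others inst') (sl σ n) }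
    ; onSVar = λ n → sub-ren-cancelS (others inst') (ss σ n)
    ; onTVar = λ c → sub-ren-cancelT (others inst') (st σ c) }

sub-instantiateS : ∀ {τ τ' σ π} → InstantiatesS τ π → InstantiatesS τ' (subS σ π) →
                   ∀ b → subT σ (subT τ b) ≡ subT τ' (subT (liftS σ) b)
sub-instantiateS {τ} {τ'} {σ} {π} inst inst' b =
  trans (sub-subT {σ₃ = σᵖ} before b) (sym (sub-subT {σ₃ = σᵖ} after b))
  where
  open InstantiatesS
  σᵖ : Subst
  σᵖ = record σ { ss = λ { zero → subS σ π ; (suc n) → ss σ n } }
  before : SubSub τ σ σᵖ
  before = record
    { onLVar = λ n → cong (subV σ) (SubRen.onLVar (others inst) n)
    ; onSVar = λ { zero → cong (subS σ) (bound inst)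
                 ; (suc n) → cong (subS σ) (SubRen.onSVar (others inst) n) }
    ; onTVar = λ c → cong (subT σ) (SubRen.onTVar (others inst) c) }
  after : SubSub (liftS σ) τ' σᵖ
  after = record
    { onLVar = λ n → sub-ren-cancelV (others inst') (sl σ n)
    ; onSVar = λ { zero → bound inst' ; (suc n) → sub-ren-cancelS (others inst') (ss σ n) }
    ; onTVar = λ c → sub-ren-cancelT (others inst') (st σ c) }

sub-[0:=]ᵛ : ∀ σ b w → subT σ (b [0:= w ]ᵛ) ≡ (subT (liftL σ) b) [0:= subV σ w ]ᵛ
sub-[0:=]ᵛ σ b w = sub-instantiateL
  record { bound = refl ; others = record { onLVar = λ _ → refl ; onSVar = λ _ → refl ; onTVar = λ _ → refl } }
  record { bound = refl ; others = record { onLVar = λ _ → refl ; onSVar = λ _ → refl ; onTVar = λ _ → refl } }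
  b

sub-[0:=]ˢ : ∀ σ b π → subT σ (b [0:= π ]ˢ) ≡ (subT (liftS σ) b) [0:= subS σ π ]ˢ
sub-[0:=]ˢ σ b π = sub-instantiateS
  record { bound = refl ; others = record { onLVar = λ _ → refl ; onSVar = λ _ → refl ; onTVar = λ _ → refl } }
  record { bound = refl ; others = record { onLVar = λ _ → refl ; onSVar = λ _ → refl ; onTVar = λ _ → refl } }
  b

termSubst : (TVar → Term) → Subst
termSubst θ = record idSubst { st = θ }

tsub-other : ∀ {a b} t → b ≢ a → st (tsub a t) b ≡ tvar b
tsub-other {a} {b} t b≢a with b ≟ a
... | yes b≡a = ⊥-elim (b≢a b≡a)
... | no _    = refl

data NotTVar : Term → Set where
  nval   : ∀ v → NotTVar (val v)
  napp   : ∀ u₁ u₂ → NotTVar (app u₁ u₂)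
  nmu    : ∀ u → NotTVar (mu u)
  nproc  : ∀ p → NotTVar (proc p)
  nproj  : ∀ v l → NotTVar (proj v l)
  ncase  : ∀ v bs → NotTVar (case v bs)
  ndelta : ∀ v w → NotTVar (delta v w)

head-view : ∀ u → (∃ λ b → u ≡ tvar b) ⊎ NotTVar u
head-view (tvar b)    = inj₁ (b , refl)
head-view (val v)     = inj₂ (nval v)
head-view (app u₁ u₂) = inj₂ (napp u₁ u₂)
head-view (mu u)      = inj₂ (nmu u)
head-view (proc p)    = inj₂ (nproc p)
head-view (proj v l)  = inj₂ (nproj v l)
head-view (case v bs) = inj₂ (ncase v bs)
head-view (delta v w) = inj₂ (ndelta v w)

sub-∈F : ∀ {σ} fs {l v'} → (l , v') ∈F subF σ fs → ∃ λ v → ((l , v) ∈F fs) × subV σ v ≡ v'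
sub-∈F (l ↦ v , fs) here = v , here , refl
sub-∈F (l ↦ v , fs) (there m) with sub-∈F fs m
... | v₀ , m₀ , eq = v₀ , there m₀ , eq

sub-∈B : ∀ {σ} bs {C u'} → (C , u') ∈B subB σ bs → ∃ λ u → ((C , u) ∈B bs) × subT (liftL σ) u ≡ u'
sub-∈B (C ⇒ u , bs) here = u , here , refl
sub-∈B (C ⇒ u , bs) (there m) with sub-∈B bs m
... | u₀ , m₀ , eq = u₀ , there m₀ , eq

module TermSubst (θ : TVar → Term) where
  σ : Subst
  σ = termSubst θ

  simulate : ∀ {u} π → NotTVar u → ∀ {q} → subP σ (u ∗ π) ≻ q →
             ∃ λ s' → (u ∗ π ≻ s') × subP σ s' ≡ q
  simulate (frame u π) (nval v) ≻-frame = u ∗ push v π , ≻-frame , refl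
  simulate (push w π) (nval (lam b)) ≻-lam =
    (b [0:= w ]ᵛ) ∗ π , ≻-lam , cong (_∗ subS σ π) (sub-[0:=]ᵛ σ b w)
  simulate π (napp u₁ u₂) ≻-app = u₂ ∗ frame u₁ π , ≻-app , refl
  simulate π (nmu b) ≻-mu = (b [0:= π ]ˢ) ∗ π , ≻-mu , cong (_∗ subS σ π) (sub-[0:=]ˢ σ b π)
  simulate π (nproc p) ≻-proc = p , ≻-proc , refl
  simulate π (nproj (rec fs) l) (≻-proj m) with sub-∈F fs m
  ... | v , m₀ , refl = val v ∗ π , ≻-proj m₀ , refl
  simulate π (ncase (con C w) bs) (≻-case m) with sub-∈B bs m
  ... | b , m₀ , refl = (b [0:= w ]ᵛ) ∗ π , ≻-case m₀ , cong (_∗ subS σ π) (sub-[0:=]ᵛ σ b w)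

  final-inversion : ∀ {u} π → NotTVar u → Final (subP σ (u ∗ π)) → Final (u ∗ π)
  final-inversion (svar α) (nval v) _ = v , α , refl
  final-inversion (push _ _) (nval _) (_ , _ , ())
  final-inversion (frame _ _) (nval _) (_ , _ , ())

  delta-inversion : ∀ {u π q B} → NotTVar u → DeltaStep B (subP σ (u ∗ π)) q →
                    ∃ λ v → ∃ λ w → u ≡ delta v w × B (subV σ v) (subV σ w)
  delta-inversion (ndelta v w) (δ-step b) = v , w , refl , b

final-blocked : ∀ {v α} → Blocked (val v ∗ svar α)
final-blocked (_ , ())

tvar-blocked : ∀ {b π} → Blocked (tvar b ∗ π)
tvar-blocked (_ , ())

delta-blocked : ∀ {v w π} → Blocked (delta v w ∗ π)
delta-blocked (_ , ())

stuck-diverges : ∀ {R : Proc → Proc → Set} {p} → (∀ {q} → ¬ R p q) → ¬ Final p → ¬ Conv R p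
stuck-diverges no-step not-final (_ , ε , fin)      = not-final fin
stuck-diverges no-step not-final (_ , step ◅ _ , _) = no-step step

tvar-diverges : ∀ {k b π} → ¬ Conv (Red k) (tvar b ∗ π)
tvar-diverges = stuck-diverges (λ { (inj₁ ()) ; (inj₂ ()) }) (λ { (_ , _ , ()) })

Bad-positive : ∀ {k v w} → Bad k v w → k > 0
Bad-positive {suc k} _ = s≤s z≤n

module _ (t : Term) (a : TVar) (k : ℕ) where
  open TermSubst (st (tsub a t)) using (simulate; final-inversion; delta-inversion)

  Shape : Proc → Set
  Shape p =
      (Σ Val λ v → Σ ℕ λ α → p ≡ (val v ∗ svar α))
    ⊎ (Σ Stack λ π → p ≡ (tvar a ∗ π))
    ⊎ (k > 0 × (Σ Val λ v → Σ Val λ w → Σ Stack λ π →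
          p ≡ (delta v w ∗ π) ×
          (Σ ℕ λ j → j < k × NotEquiv j (val (v [ a := t ]ⱽ)) (val (w [ a := t ]ⱽ)))))

  Outcome : Proc → Set
  Outcome s = Σ Proc λ p → Star _≻_ s p × Blocked p × Shape p

  step-back : ∀ {s s'} → s ≻ s' → Outcome s' → Outcome s
  step-back s≻s' (p , s'≻*p , blocked , shape) = p , s≻s' ◅ s'≻*p , blocked , shape

  -- A converging instance of a term-variable head has head a, since any
  -- other term variable is left in place by [a:=t] and is stuck.
  head-is-a : ∀ {b π} → Conv (Red k) ((tvar b ∗ π) [ a := t ]ᴾ) → b ≡ a
  head-is-a {b} {π} conv = decidable-stable (b ≟ a) λ b≢a →
    tvar-diverges (subst (λ h → Conv (Red k) (h ∗ subS (tsub a t) π)) (tsub-other t b≢a) conv)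

  mutual
    walk : ∀ s {q} → Star (Red k) (s [ a := t ]ᴾ) q → Final q → Outcome s
    walk (u ∗ π) path fin with head-view u
    ... | inj₂ nv = walk-from π nv path fin
    ... | inj₁ (b , refl) with head-is-a {π = π} (_ , path , fin)
    ...   | refl = tvar a ∗ π , ε , tvar-blocked , inj₂ (inj₁ (π , refl))

    walk-from : ∀ {u} π → NotTVar u → ∀ {q} → Star (Red k) ((u ∗ π) [ a := t ]ᴾ) q → Final q → Outcome (u ∗ π)
    walk-from π nv ε fin with final-inversion π nv fin
    ... | v , α , refl = val v ∗ svar α , ε , final-blocked , inj₁ (v , α , refl)
    walk-from π nv (inj₁ step ◅ path) fin with simulate π nv step
    ... | s' , s≻s' , refl = step-back s≻s' (walk s' path fin)
    walk-from π nv (inj₂ δ ◅ _) _ with delta-inversion {π = π} nv δ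
    ... | v , w , refl , bad = delta v w ∗ π , ε , delta-blocked ,
          inj₂ (inj₂ (Bad-positive bad , v , w , π , refl , Equivalence.to (Bad-spec k) bad))

lemma5 : (s : Proc) (t : Term) (a : TVar) (k : ℕ) →
    Conv (Red k) (s [ a := t ]ᴾ) →
    Σ Proc λ p → Star _≻_ s p × Blocked p ×
      ( (Σ Val λ v → Σ ℕ λ α → p ≡ (val v ∗ svar α))
      ⊎ (Σ Stack λ π → p ≡ (tvar a ∗ π))
      ⊎ (k > 0 × (Σ Val λ v → Σ Val λ w → Σ Stack λ π →
            p ≡ (delta v w ∗ π) ×
            (Σ ℕ λ j → j < k × NotEquiv j (val (v [ a := t ]ⱽ)) (val (w [ a := t ]ⱽ))))) )
lemma5 s t a k (_ , path , fin) = walk t a k s path fin
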